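{- Let $a,b$ be parameters with $a\neq 0$, and work with formal power series in $x$. Let $Z_1(a,b;x)=S(a,b;-x)\,S\!\left(a,b;\tfrac{b}{a}xS(a,b;-x)^2\right)$. Then $$Z_1(a,b;x)=1-axZ_1(a,b;x)+\frac{b^2}{a}xZ_1(a,b;x)^2.$$ Moreover, define $Z_0(a,b;x)=S(-a,b;x)$ and, for $m\ge 0$, $$Z_{m+1}(a,b;x)=Z_m(a,b;x)\,Z_m\!\left(a,b;\frac{b^{2^m}}{a^{2^m}}xZ_m(a,b;x)^2\right).$$ Then for every $m\ge 0$, $$Z_m(a,b;x)=1-axZ_m(a,b;x)+\frac{b^{2^m}}{a^{2^m-1}}xZ_m(a,b;x)^2,$$ and $$Z_m(a,b;x)=S\!\left(-a,\frac{b^{2^m}}{a^{2^m-1}};x\right)=\frac{1+ax-\sqrt{(1+ax)^2-4\frac{b^{2^m}}{a^{2^m-1}}x}}{2\frac{b^{2^m}}{a^{2^m-1}}x}.$$ In particular $Z_m(a,b;x)=Z_m(a,-b;x)$ for $m\ge 1$, and $Z_m(a,a;x)=S(-a,a;x)=1$ for $m\ge 0$. (The series $Z_1$ defined by the first formula coincides with $Z_1$ defined by the recursion.)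
   Context: For parameters $a,b$, $S(a,b;x)=\sum_{n\ge0}S_n(a,b)x^n$ is the unique formal power series satisfying $S(a,b;x)=1+axS(a,b;x)+bxS(a,b;x)^2$; explicitly $S(a,b;x)=\frac{1-ax-\sqrt{(1-ax)^2-4bx}}{2bx}$ and $S_n(a,b)=\sum_{k=0}^{n}\binom{n+k}{2k}C_k a^{n-k}b^k$ with $C_k=\frac{1}{k+1}\binom{2k}{k}$. It is the generating function of Schröder paths (steps $(1,1)$, $(1,-1)$, $(2,0)$ from $(0,0)$ to $(2n,0)$ weakly above the axis) weighted by $a$ per horizontal step and $b$ per down step. -}

module Defs where

open import Level using (_⊔_)
open import Data.Nat as ℕ using (ℕ; zero; suc)
open import Data.Nat.Combinatorics using (_C_)
open import Algebra.Bundles using (CommutativeRing)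

catalan : ℕ → ℕ
catalan k = ((2 ℕ.* k) C k) ℕ./ (suc k)

module PowerSeries {c ℓ} (R : CommutativeRing c ℓ) where
  open CommutativeRing R public

  pow : Carrier → ℕ → Carrier
  pow x zero = 1#
  pow x (suc n) = x * pow x n

  fromℕ : ℕ → Carrier
  fromℕ zero = 0#
  fromℕ (suc n) = 1# + fromℕ n

  sumTo : ℕ → (ℕ → Carrier) → Carrier
  sumTo zero f = 0#
  sumTo (suc n) f = sumTo n f + f n

  PS : Set c
  PS = ℕ → Carrier

  infix 4 _≋_
  _≋_ : PS → PS → Set ℓ
  f ≋ g = ∀ n → f n ≈ g n

  const : Carrier → PS
  const r zero = r
  const r (suc n) = 0#

  one : PS
  one = const 1#

  _·_ : Carrier → PS → PS
  (r · f) n = r * f n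

  X* : PS → PS
  X* f zero = 0#
  X* f (suc n) = f n

  infixl 6 _⊕_ _⊖_
  _⊕_ : PS → PS → PS
  (f ⊕ g) n = f n + g n

  _⊖_ : PS → PS → PS
  (f ⊖ g) n = f n - g n

  infixl 7 _⊛_
  _⊛_ : PS → PS → PS
  (f ⊛ g) n = sumTo (suc n) (λ i → f i * g (n ℕ.∸ i))

  powPS : PS → ℕ → PS
  powPS f zero = one
  powPS f (suc k) = f ⊛ powPS f k

  -- substitution f(g(x)); meaningful when g has zero constant term
  -- (only then is [x^n] f(g) = Σ_{k ≤ n} f_k [x^n] g^k); all uses below
  -- substitute series of the form x·h(x).
  _∘ₛ_ : PS → PS → PS
  (f ∘ₛ g) n = sumTo (suc n) (λ k → f k * powPS g k n)

  negX : PS → PS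
  negX f n = pow (- 1#) n * f n

  S : Carrier → Carrier → PS
  S a b n = sumTo (suc n) (λ k →
    fromℕ (((n ℕ.+ k) C (2 ℕ.* k)) ℕ.* catalan k) * (pow a (n ℕ.∸ k) * pow b k))

  -- Given a⁻¹ (an inverse of a), the Z-series of Lemma 2.2.
  module _ (a b a⁻¹ : Carrier) where
    Z1′ : PS
    Z1′ = negX (S a b) ⊛ (S a b ∘ₛ ((b * a⁻¹) · X* (negX (S a b) ⊛ negX (S a b))))

    Z : ℕ → PS
    Z zero = S (- a) b
    Z (suc m) = Z m ⊛ (Z m ∘ₛ ((pow b (2 ℕ.^ m) * pow a⁻¹ (2 ℕ.^ m)) · X* (Z m ⊛ Z m)))

    d : ℕ → Carrier
    d m = pow b (2 ℕ.^ m) * pow a⁻¹ ((2 ℕ.^ m) ℕ.∸ 1)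

-- Everything rests on one composition step: if T(1 + a x) = 1 + γ x T²,
-- V(1 + a′ y) = 1 + γ′ y V² and a′ k = γ, then U = T · V(k x T²) satisfies
-- U(1 + a x) = 1 + γ′ k x U². The series S(α,β) is itself such a composite, of the geometric
-- series 1/(1 − α x) and the Catalan series C = 1 + x C², which gives its quadratic equation;
-- Z₁ is the composite of S(a,b;−x) = S(−a,−b;x) with S(a,b), and Z_{m+1} that of Z_m with
-- itself. A quadratic equation of this shape has exactly one power-series solution, so the
-- remaining identities reduce to identities between the coefficients a, γ. The Catalan
-- recurrence is derived from the closed formula through ballot numbers.

module Submission where

open import Defs
open import Data.Nat using (ℕ; suc)
open import Data.Product using () renaming (_×_ to _∧_)
open import Algebra.Bundles using (CommutativeRing)
open import Data.Product using (_,_)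

module Combinatorics where
  open import Data.Nat using (ℕ; zero; suc; _+_; _*_; _∸_; _^_; _/_; _≤_)
  open import Data.Nat.Properties using (suc-injective; +-identityʳ; +-assoc; +-comm; +-cancelˡ-≡; *-comm; *-distribˡ-+; *-identityˡ; *-identityʳ; *-zeroʳ; m≤m+n; m+n∸m≡n; m+[n∸m]≡n)
  open import Data.Nat.Combinatorics using (_C_; nCk≡nC[n∸k]; nCk+nC[k+1]≡[n+1]C[k+1]; nC1≡n)
  open import Data.Nat.DivMod using (m*n/n≡m)
  open import Data.Nat.Solver using (module +-*-Solver)
  open import Relation.Binary.PropositionalEquality using (_≡_; refl; cong; cong₂; sym; trans; module ≡-Reasoning)
  open +-*-Solver using (solve; _:=_; _:+_; _:*_; con)
  open ≡-Reasoning

  C-sym : ∀ {n} i j → n ≡ i + j → n C i ≡ n C j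
  C-sym i j refl = trans (nCk≡nC[n∸k] (m≤m+n i j)) (cong ((i + j) C_) (m+n∸m≡n i j))

  pascal : ∀ n k → suc n C suc k ≡ n C k + n C suc k
  pascal n k = sym (nCk+nC[k+1]≡[n+1]C[k+1] n k)

  C-diagonal : ∀ {k n} → k ≤ n → (2 * k + (n ∸ k)) C (n ∸ k) ≡ (n + k) C (2 * k)
  C-diagonal {k} {n} k≤n = sym (trans (C-sym (2 * k) (n ∸ k) n+k≡2k+j) (cong (_C (n ∸ k)) n+k≡2k+j))
    where
    n+k≡2k+j : n + k ≡ 2 * k + (n ∸ k)
    n+k≡2k+j = trans (cong (_+ k) (sym (m+[n∸m]≡n k≤n))) (solve 2 (λ k j → (k :+ j) :+ k := con 2 :* k :+ j) refl k (n ∸ k))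

  absorption : ∀ n k → suc k * (suc n C suc k) ≡ suc n * (n C k)
  absorption zero    zero    = refl
  absorption zero    (suc k) = *-zeroʳ (suc (suc k))
  absorption (suc n) zero    = trans (*-identityˡ _) (trans (nC1≡n (suc (suc n))) (sym (*-identityʳ _)))
  absorption (suc n) (suc k) = begin
    suc (suc k) * (suc (suc n) C suc (suc k))    ≡⟨ cong (suc (suc k) *_) (pascal (suc n) (suc k)) ⟩
    suc (suc k) * (A + B)                        ≡⟨ solve 3 (λ k A B → (con 1 :+ k) :* (A :+ B) := A :+ k :* A :+ (con 1 :+ k) :* B) refl (suc k) A B ⟩
    A + suc k * A + suc (suc k) * B              ≡⟨ cong₂ (λ u v → A + u + v) (absorption n k) (absorption n (suc k)) ⟩
    A + suc n * (n C k) + suc n * (n C suc k)    ≡⟨ solve 4 (λ A m x y → A :+ m :* x :+ m :* y := A :+ m :* (x :+ y)) refl A (suc n) (n C k) (n C suc k) ⟩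
    A + suc n * (n C k + n C suc k)              ≡⟨ cong (λ z → A + suc n * z) (pascal n k) ⟨
    suc (suc n) * A                              ∎
    where
    A = suc n C suc k
    B = suc n C suc (suc k)

  -- ballot j h = [xʲ] C(x)^(h+1) for the Catalan series C = 1 + x C²;
  -- the last clause is C^(h+2) = C^(h+1) + x C^(h+3).
  ballot : ℕ → ℕ → ℕ
  ballot zero    h       = 1
  ballot (suc j) zero    = ballot j 1
  ballot (suc j) (suc h) = ballot (suc j) h + ballot j (2 + h)

  ballot-difference : ∀ j h n → n ≡ 2 + (j + j + h) → ballot (suc j) h + n C j ≡ n C suc j
  ballot-difference zero zero .2 refl = refl
  ballot-difference zero (suc h) (suc M) eq = begin
    ballot 1 h + 1 + suc M C 0   ≡⟨ cong (_+ 1) (ballot-difference zero h M (suc-injective eq)) ⟩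
    M C 1 + 1                    ≡⟨ +-comm (M C 1) 1 ⟩
    M C 0 + M C 1                ≡⟨ pascal M 0 ⟨
    suc M C 1                    ∎
  ballot-difference (suc j) zero (suc M) eq = begin
    ballot (suc j) 1 + suc M C suc j       ≡⟨ cong (ballot (suc j) 1 +_) (pascal M j) ⟩
    ballot (suc j) 1 + (M C j + M C suc j) ≡⟨ +-assoc (ballot (suc j) 1) _ _ ⟨
    ballot (suc j) 1 + M C j + M C suc j   ≡⟨ cong (_+ M C suc j) (ballot-difference j 1 M M≡) ⟩
    M C suc j + M C suc j                  ≡⟨ cong (M C suc j +_) (C-sym (suc j) (suc (suc j)) (trans M≡ (solve 1 (λ j → con 2 :+ (j :+ j :+ con 1) := (con 1 :+ j) :+ (con 2 :+ j)) refl j))) ⟩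
    M C suc j + M C suc (suc j)            ≡⟨ pascal M (suc j) ⟨
    suc M C suc (suc j)                    ∎
    where
    M≡ : M ≡ 2 + (j + j + 1)
    M≡ = trans (suc-injective eq) (solve 1 (λ j → con 1 :+ ((con 1 :+ j) :+ (con 1 :+ j) :+ con 0) := con 2 :+ (j :+ j :+ con 1)) refl j)
  ballot-difference (suc j) (suc h) (suc M) eq = begin
    E₁ + E₂ + suc M C suc j                  ≡⟨ cong (E₁ + E₂ +_) (pascal M j) ⟩
    E₁ + E₂ + (M C j + M C suc j)            ≡⟨ solve 4 (λ a b x y → (a :+ b) :+ (x :+ y) := (a :+ y) :+ (b :+ x)) refl E₁ E₂ (M C j) (M C suc j) ⟩
    (E₁ + M C suc j) + (E₂ + M C j)          ≡⟨ cong₂ _+_ (ballot-difference (suc j) h M M≡₁) (ballot-difference j (2 + h) M M≡₂) ⟩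
    M C suc (suc j) + M C suc j              ≡⟨ +-comm (M C suc (suc j)) (M C suc j) ⟩
    M C suc j + M C suc (suc j)              ≡⟨ pascal M (suc j) ⟨
    suc M C suc (suc j)                      ∎
    where
    E₁ = ballot (suc (suc j)) h
    E₂ = ballot (suc j) (2 + h)
    M≡₁ : M ≡ 2 + (suc j + suc j + h)
    M≡₁ = trans (suc-injective eq) (solve 2 (λ j h → con 1 :+ ((con 1 :+ j) :+ (con 1 :+ j) :+ (con 1 :+ h)) := con 2 :+ ((con 1 :+ j) :+ (con 1 :+ j) :+ h)) refl j h)
    M≡₂ : M ≡ 2 + (j + j + (2 + h))
    M≡₂ = trans M≡₁ (solve 2 (λ j h → con 2 :+ ((con 1 :+ j) :+ (con 1 :+ j) :+ h) := con 2 :+ (j :+ j :+ (con 2 :+ h))) refl j h)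

  central-binomial≡ballot : ∀ k → (2 * k) C k ≡ ballot k 0 * suc k
  central-binomial≡ballot zero    = refl
  central-binomial≡ballot (suc j) = +-cancelˡ-≡ (suc j * y) y (e * suc (suc j)) (begin
    suc j * y + y                      ≡⟨ +-comm (suc j * y) y ⟩
    suc (suc j) * y                    ≡⟨ cong (suc (suc j) *_) (ballot-difference j 0 M M≡) ⟨
    suc (suc j) * (e + x)              ≡⟨ *-distribˡ-+ (suc (suc j)) e x ⟩
    suc (suc j) * e + suc (suc j) * x  ≡⟨ cong (suc (suc j) * e +_) symmetric-absorption ⟨
    suc (suc j) * e + suc j * y        ≡⟨ +-comm (suc (suc j) * e) (suc j * y) ⟩
    suc j * y + suc (suc j) * e        ≡⟨ cong (suc j * y +_) (*-comm (suc (suc j)) e) ⟩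
    suc j * y + e * suc (suc j)        ∎)
    where
    M = 2 * suc j
    M′ = suc (j + j)
    M≡ : M ≡ 2 + (j + j + 0)
    M≡ = solve 1 (λ j → con 2 :* (con 1 :+ j) := con 2 :+ (j :+ j :+ con 0)) refl j
    e = ballot (suc j) 0
    x = M C j
    y = M C suc j
    symmetric-absorption : suc j * y ≡ suc (suc j) * x
    symmetric-absorption = begin
      suc j * y                              ≡⟨ cong (λ n → suc j * (n C suc j)) (solve 1 (λ j → con 2 :* (con 1 :+ j) := con 1 :+ (con 1 :+ (j :+ j))) refl j) ⟩
      suc j * (suc M′ C suc j)               ≡⟨ absorption M′ j ⟩
      suc M′ * (M′ C j)                      ≡⟨ cong (suc M′ *_) (C-sym j (suc j) (solve 1 (λ j → con 1 :+ (j :+ j) := j :+ (con 1 :+ j)) refl j)) ⟩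
      suc M′ * (M′ C suc j)                  ≡⟨ absorption M′ (suc j) ⟨
      suc (suc j) * (suc M′ C suc (suc j))   ≡⟨ cong (suc (suc j) *_) (C-sym (suc (suc j)) j (solve 1 (λ j → con 1 :+ (con 1 :+ (j :+ j)) := (con 2 :+ j) :+ j) refl j)) ⟩
      suc (suc j) * (suc M′ C j)             ≡⟨ cong (λ n → suc (suc j) * (n C j)) (solve 1 (λ j → con 1 :+ (con 1 :+ (j :+ j)) := con 2 :* (con 1 :+ j)) refl j) ⟩
      suc (suc j) * x                        ∎

  catalan≡ballot : ∀ k → catalan k ≡ ballot k 0
  catalan≡ballot k = trans (cong (_/ suc k) (central-binomial≡ballot k)) (m*n/n≡m (ballot k 0) (suc k))

  2^-pred : ∀ m → 2 ^ m ≡ suc (2 ^ m ∸ 1)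
  2^-pred zero    = refl
  2^-pred (suc m) rewrite 2^-pred m = refl

  2^-suc : ∀ m → 2 ^ suc m ≡ 2 ^ m + 2 ^ m
  2^-suc m = cong (2 ^ m +_) (+-identityʳ (2 ^ m))

  2^-suc-pred : ∀ m → 2 ^ suc m ∸ 1 ≡ (2 ^ m ∸ 1) + 2 ^ m
  2^-suc-pred m = trans (cong (_∸ 1) (2^-suc m)) (cong (λ n → n + 2 ^ m ∸ 1) (2^-pred m))

module Series {c ℓ} (R : CommutativeRing c ℓ) where
  open import Level using (_⊔_)
  open import Data.Nat as ℕ using (zero; _<_; _≤_; s≤s; z≤n)
  open import Data.Nat.Properties as ℕ using ()
  open import Data.Nat.Induction using (<-rec)
  open import Data.Nat.Combinatorics using (_C_; nCn≡1)
  open import Relation.Binary.PropositionalEquality as ≡ using (_≡_)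
  open import Relation.Binary.Bundles using (Setoid)
  open import Algebra.Bundles using (CommutativeSemiring)
  import Relation.Binary.Reasoning.Setoid as SetoidReasoning
  import Algebra.Solver.Ring.NaturalCoefficients.Default as NaturalCoefficients
  open Combinatorics using (pascal; C-diagonal; ballot; catalan≡ballot; 2^-pred; 2^-suc; 2^-suc-pred)

  open PowerSeries R public
  open import Algebra.Properties.Semiring.Mult semiring using (_×_; ×-homo-+; ×1-homo-*)
  open import Algebra.Properties.CommutativeSemiring.Exp commutativeSemiring using (_^_; ^-homo-*; ^-distrib-*)
  open import Algebra.Properties.CommutativeSemigroup *-commutativeSemigroup using (x∙yz≈y∙xz)
  open import Algebra.Properties.Ring ring using (+-cancelʳ; -‿distribˡ-*; -‿distribʳ-*; -‿involutive; -1*x≈-x)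

  module ≈-Solver = NaturalCoefficients commutativeSemiring using (solve; _:=_; _:+_; _:*_; con)
  module ≈-Reasoning = SetoidReasoning setoid

  sumTo-cong< : ∀ n {f g : ℕ → Carrier} → (∀ i → i < n → f i ≈ g i) → sumTo n f ≈ sumTo n g
  sumTo-cong< zero    f≈g = refl
  sumTo-cong< (suc n) f≈g = +-cong (sumTo-cong< n (λ i i<n → f≈g i (ℕ.m<n⇒m<1+n i<n))) (f≈g n (ℕ.n<1+n n))

  sumTo-cong : ∀ n {f g : ℕ → Carrier} → (∀ i → f i ≈ g i) → sumTo n f ≈ sumTo n g
  sumTo-cong n f≈g = sumTo-cong< n (λ i _ → f≈g i)

  sumTo-0 : ∀ n {f : ℕ → Carrier} → (∀ i → i < n → f i ≈ 0#) → sumTo n f ≈ 0#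
  sumTo-0 zero    f≈0 = refl
  sumTo-0 (suc n) f≈0 = trans (+-cong (sumTo-0 n (λ i i<n → f≈0 i (ℕ.m<n⇒m<1+n i<n))) (f≈0 n (ℕ.n<1+n n))) (+-identityʳ 0#)

  sumTo-+ : ∀ n (f g : ℕ → Carrier) → sumTo n (λ i → f i + g i) ≈ sumTo n f + sumTo n g
  sumTo-+ zero    f g = sym (+-identityʳ 0#)
  sumTo-+ (suc n) f g = trans (+-congʳ (sumTo-+ n f g))
    (solve 4 (λ a b u v → (a :+ b) :+ (u :+ v) := (a :+ u) :+ (b :+ v)) refl (sumTo n f) (sumTo n g) (f n) (g n))
    where open ≈-Solver

  *-distribˡ-sumTo : ∀ n r (f : ℕ → Carrier) → r * sumTo n f ≈ sumTo n (λ i → r * f i)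
  *-distribˡ-sumTo zero    r f = zeroʳ r
  *-distribˡ-sumTo (suc n) r f = trans (distribˡ r (sumTo n f) (f n)) (+-congʳ (*-distribˡ-sumTo n r f))

  sumTo-unconsˡ : ∀ n (f : ℕ → Carrier) → sumTo (suc n) f ≈ f 0 + sumTo n (λ i → f (suc i))
  sumTo-unconsˡ zero    f = trans (+-identityˡ _) (sym (+-identityʳ _))
  sumTo-unconsˡ (suc n) f = trans (+-congʳ (sumTo-unconsˡ n f)) (+-assoc _ _ _)

  sumTo-reverse : ∀ n (f : ℕ → Carrier) → sumTo (suc n) f ≈ sumTo (suc n) (λ i → f (n ℕ.∸ i))
  sumTo-reverse zero    f = refl
  sumTo-reverse (suc n) f = begin
    sumTo (suc n) f + f (suc n)                         ≈⟨ +-congʳ (sumTo-reverse n f) ⟩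
    sumTo (suc n) (λ i → f (n ℕ.∸ i)) + f (suc n)       ≈⟨ +-comm _ _ ⟩
    f (suc n) + sumTo (suc n) (λ i → f (n ℕ.∸ i))       ≈⟨ sumTo-unconsˡ (suc n) (λ i → f (suc n ℕ.∸ i)) ⟨
    sumTo (suc (suc n)) (λ i → f (suc n ℕ.∸ i))         ∎
    where open ≈-Reasoning

  sumTo-swap : ∀ m n (f : ℕ → ℕ → Carrier) →
    sumTo m (λ i → sumTo n (λ k → f i k)) ≈ sumTo n (λ k → sumTo m (λ i → f i k))
  sumTo-swap zero    n f = sym (sumTo-0 n (λ _ _ → refl))
  sumTo-swap (suc m) n f = trans (+-congʳ (sumTo-swap m n f)) (sym (sumTo-+ n _ _))

  sumTo-extend : ∀ {m n} {f : ℕ → Carrier} → m ≤ n → (∀ i → m ≤ i → f i ≈ 0#) → sumTo m f ≈ sumTo n f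
  sumTo-extend {m} {f = f} m≤n f≈0 = go (ℕ.≤⇒≤′ m≤n)
    where
    go : ∀ {n} → m ℕ.≤′ n → sumTo m f ≈ sumTo n f
    go ℕ.≤′-refl                  = refl
    go {suc n} (ℕ.≤′-step m≤′n) = trans (go m≤′n) (sym (trans (+-congˡ (f≈0 n (ℕ.≤′⇒≤ m≤′n))) (+-identityʳ _)))

  fromℕ≡× : ∀ n → fromℕ n ≡ n × 1#
  fromℕ≡× zero    = ≡.refl
  fromℕ≡× (suc n) = ≡.cong (1# +_) (fromℕ≡× n)

  fromℕ-+ : ∀ m n → fromℕ (m ℕ.+ n) ≈ fromℕ m + fromℕ n
  fromℕ-+ m n rewrite fromℕ≡× (m ℕ.+ n) | fromℕ≡× m | fromℕ≡× n = ×-homo-+ 1# m n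

  fromℕ-* : ∀ m n → fromℕ (m ℕ.* n) ≈ fromℕ m * fromℕ n
  fromℕ-* m n rewrite fromℕ≡× (m ℕ.* n) | fromℕ≡× m | fromℕ≡× n = ×1-homo-* m n

  pow≡^ : ∀ x n → pow x n ≡ x ^ n
  pow≡^ x zero    = ≡.refl
  pow≡^ x (suc n) = ≡.cong (x *_) (pow≡^ x n)

  pow-+ : ∀ x m n → pow x (m ℕ.+ n) ≈ pow x m * pow x n
  pow-+ x m n rewrite pow≡^ x (m ℕ.+ n) | pow≡^ x m | pow≡^ x n = ^-homo-* x m n

  pow-* : ∀ x y n → pow (x * y) n ≈ pow x n * pow y n
  pow-* x y n rewrite pow≡^ (x * y) n | pow≡^ x n | pow≡^ y n = ^-distrib-* x y n

  pow-cong : ∀ {x y} n → x ≈ y → pow x n ≈ pow y n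
  pow-cong zero    x≈y = refl
  pow-cong (suc n) x≈y = *-cong x≈y (pow-cong n x≈y)

  -- The semiring of power series

  ≋-refl : ∀ {F} → F ≋ F
  ≋-refl n = refl

  ≋-sym : ∀ {F G} → F ≋ G → G ≋ F
  ≋-sym F≋G n = sym (F≋G n)

  ≋-trans : ∀ {F G H} → F ≋ G → G ≋ H → F ≋ H
  ≋-trans F≋G G≋H n = trans (F≋G n) (G≋H n)

  ≋-setoid : Setoid c ℓ
  ≋-setoid = record
    { Carrier = PS
    ; _≈_ = _≋_
    ; isEquivalence = record { refl = ≋-refl ; sym = ≋-sym ; trans = ≋-trans }
    }

  module ≋-Reasoning = SetoidReasoning ≋-setoid
  open import Algebra.Structures.Biased _≋_ using (isCommutativeMonoidˡ; isCommutativeSemiringˡ)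

  0ₛ : PS
  0ₛ _ = 0#

  X : PS
  X = X* one

  tail : PS → PS
  tail F n = F (suc n)

  ⊕-cong : ∀ {F F′ G G′} → F ≋ F′ → G ≋ G′ → F ⊕ G ≋ F′ ⊕ G′
  ⊕-cong F≋F′ G≋G′ n = +-cong (F≋F′ n) (G≋G′ n)

  ⊛-cong-≤ : ∀ n {F F′ G G′} → (∀ i → i ≤ n → F i ≈ F′ i) → (∀ i → i ≤ n → G i ≈ G′ i) →
    (F ⊛ G) n ≈ (F′ ⊛ G′) n
  ⊛-cong-≤ n F≈F′ G≈G′ = sumTo-cong< (suc n) (λ i i<1+n → *-cong (F≈F′ i (ℕ.≤-pred i<1+n)) (G≈G′ (n ℕ.∸ i) (ℕ.m∸n≤m n i)))

  ⊛-cong : ∀ {F F′ G G′} → F ≋ F′ → G ≋ G′ → F ⊛ G ≋ F′ ⊛ G′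
  ⊛-cong F≋F′ G≋G′ n = ⊛-cong-≤ n (λ i _ → F≋F′ i) (λ i _ → G≋G′ i)

  ⊛-comm : ∀ F G → F ⊛ G ≋ G ⊛ F
  ⊛-comm F G n = trans (sumTo-reverse n _) (sumTo-cong< (suc n) swap)
    where
    swap : ∀ i → i < suc n → F (n ℕ.∸ i) * G (n ℕ.∸ (n ℕ.∸ i)) ≈ G i * F (n ℕ.∸ i)
    swap i i<1+n rewrite ℕ.m∸[m∸n]≡n (ℕ.≤-pred i<1+n) = *-comm _ _

  ⊛-unconsˡ : ∀ F G n → (F ⊛ G) (suc n) ≈ F 0 * G (suc n) + (tail F ⊛ G) n
  ⊛-unconsˡ F G n = sumTo-unconsˡ (suc n) _

  const-⊛ : ∀ r F → const r ⊛ F ≋ r · F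
  const-⊛ r F n = begin
    (const r ⊛ F) n                                    ≈⟨ sumTo-unconsˡ n _ ⟩
    r * F n + sumTo n (λ i → 0# * F (n ℕ.∸ suc i))     ≈⟨ +-congˡ (sumTo-0 n (λ i _ → zeroˡ _)) ⟩
    r * F n + 0#                                       ≈⟨ +-identityʳ _ ⟩
    r * F n                                            ∎
    where open ≈-Reasoning

  ⊛-identityˡ : ∀ F → one ⊛ F ≋ F
  ⊛-identityˡ F n = trans (const-⊛ 1# F n) (*-identityˡ (F n))

  ⊛-zeroˡ : ∀ F → 0ₛ ⊛ F ≋ 0ₛ
  ⊛-zeroˡ F n = sumTo-0 (suc n) (λ i _ → zeroˡ _)

  ⊛-distribʳ : ∀ H F G → (F ⊕ G) ⊛ H ≋ F ⊛ H ⊕ G ⊛ H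
  ⊛-distribʳ H F G n = trans (sumTo-cong (suc n) (λ i → distribʳ _ _ _)) (sumTo-+ (suc n) _ _)

  ·-⊛ : ∀ r F G → (r · F) ⊛ G ≋ r · (F ⊛ G)
  ·-⊛ r F G n = trans (sumTo-cong (suc n) (λ i → *-assoc _ _ _)) (sym (*-distribˡ-sumTo (suc n) r _))

  tail-⊛ : ∀ F G → tail (F ⊛ G) ≋ F 0 · tail G ⊕ tail F ⊛ G
  tail-⊛ F G = ⊛-unconsˡ F G

  ⊛-assoc : ∀ F G H → (F ⊛ G) ⊛ H ≋ F ⊛ (G ⊛ H)
  ⊛-assoc F G H zero    = trans (+-identityˡ _) (trans (*-congʳ (+-identityˡ _)) (trans (*-assoc _ _ _)
                            (sym (trans (+-identityˡ _) (*-congˡ (+-identityˡ _))))))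
  ⊛-assoc F G H (suc n) = begin
    ((F ⊛ G) ⊛ H) (suc n)                                        ≈⟨ ⊛-unconsˡ (F ⊛ G) H n ⟩
    (F ⊛ G) 0 * H (suc n) + (tail (F ⊛ G) ⊛ H) n                 ≈⟨ +-cong (*-congʳ (+-identityˡ _)) (⊛-cong {G = H} (tail-⊛ F G) ≋-refl n) ⟩
    F 0 * G 0 * H (suc n) + ((F 0 · tail G ⊕ tail F ⊛ G) ⊛ H) n  ≈⟨ +-congˡ (⊛-distribʳ H _ _ n) ⟩
    F 0 * G 0 * H (suc n) + (((F 0 · tail G) ⊛ H) n + ((tail F ⊛ G) ⊛ H) n)
                                                                 ≈⟨ +-congˡ (+-cong (·-⊛ (F 0) (tail G) H n) (⊛-assoc (tail F) G H n)) ⟩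
    F 0 * G 0 * H (suc n) + (F 0 * (tail G ⊛ H) n + (tail F ⊛ (G ⊛ H)) n)
                                                                 ≈⟨ solve 5 (λ f g h u v → f :* g :* h :+ (f :* u :+ v) := f :* (g :* h :+ u) :+ v)
                                                                      refl (F 0) (G 0) (H (suc n)) ((tail G ⊛ H) n) ((tail F ⊛ (G ⊛ H)) n) ⟩
    F 0 * (G 0 * H (suc n) + (tail G ⊛ H) n) + (tail F ⊛ (G ⊛ H)) n ≈⟨ +-congʳ (*-congˡ (⊛-unconsˡ G H n)) ⟨
    F 0 * (G ⊛ H) (suc n) + (tail F ⊛ (G ⊛ H)) n                 ≈⟨ ⊛-unconsˡ F (G ⊛ H) n ⟨
    (F ⊛ (G ⊛ H)) (suc n)                                        ∎
    where
    open ≈-Reasoning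
    open ≈-Solver

  PS-commutativeSemiring : CommutativeSemiring c ℓ
  PS-commutativeSemiring = record
    { isCommutativeSemiring = isCommutativeSemiringˡ record
      { +-isCommutativeMonoid = isCommutativeMonoidˡ record
        { isSemigroup = record
          { isMagma = record { isEquivalence = Setoid.isEquivalence ≋-setoid ; ∙-cong = ⊕-cong }
          ; assoc = λ F G H n → +-assoc (F n) (G n) (H n) }
        ; identityˡ = λ F n → +-identityˡ (F n)
        ; comm = λ F G n → +-comm (F n) (G n) }
      ; *-isCommutativeMonoid = isCommutativeMonoidˡ record
        { isSemigroup = record
          { isMagma = record { isEquivalence = Setoid.isEquivalence ≋-setoid ; ∙-cong = ⊛-cong }
          ; assoc = ⊛-assoc }
        ; identityˡ = ⊛-identityˡ
        ; comm = ⊛-comm }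
      ; distribʳ = ⊛-distribʳ
      ; zeroˡ = ⊛-zeroˡ }
    }

  module ≋-Solver = NaturalCoefficients PS-commutativeSemiring using (solve; _:=_; _:+_; _:*_; con)
  open import Algebra.Properties.CommutativeSemiring.Exp PS-commutativeSemiring
    using () renaming (_^_ to _^ₛ_; ^-homo-* to ^ₛ-homo-⊛; ^-distrib-* to ^ₛ-distrib-⊛)

  ·-cong : ∀ {r s F G} → r ≈ s → F ≋ G → r · F ≋ s · G
  ·-cong r≈s F≋G n = *-cong r≈s (F≋G n)

  X*-cong : ∀ {F G} → F ≋ G → X* F ≋ X* G
  X*-cong F≋G zero    = refl
  X*-cong F≋G (suc n) = F≋G n

  const-cong : ∀ {r s} → r ≈ s → const r ≋ const s
  const-cong r≈s zero    = r≈s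
  const-cong r≈s (suc n) = refl

  const-0# : const 0# ≋ 0ₛ
  const-0# zero    = refl
  const-0# (suc n) = refl

  ·-one : ∀ r → r · one ≋ const r
  ·-one r zero    = *-identityʳ r
  ·-one r (suc n) = zeroʳ r

  const-* : ∀ r s → const (r * s) ≋ const r ⊛ const s
  const-* r s = ≋-sym (≋-trans (const-⊛ r (const s)) λ { zero → refl ; (suc n) → zeroʳ r })

  X*≋X⊛ : ∀ F → X* F ≋ X ⊛ F
  X*≋X⊛ F zero    = sym (trans (+-identityˡ _) (zeroˡ _))
  X*≋X⊛ F (suc n) = sym (trans (⊛-unconsˡ X F n) (trans (+-cong (zeroˡ _) (⊛-identityˡ F n)) (+-identityˡ _)))

  ·X*≋const⊛X⊛ : ∀ r F → r · X* F ≋ const r ⊛ (X ⊛ F)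
  ·X*≋const⊛X⊛ r F = ≋-trans (·-cong refl (X*≋X⊛ F)) (≋-sym (const-⊛ r (X ⊛ F)))

  powPS≡^ₛ : ∀ F k → powPS F k ≡ F ^ₛ k
  powPS≡^ₛ F zero    = ≡.refl
  powPS≡^ₛ F (suc k) = ≡.cong (F ⊛_) (powPS≡^ₛ F k)

  powPS-cong : ∀ {F G} k → F ≋ G → powPS F k ≋ powPS G k
  powPS-cong zero    F≋G = ≋-refl
  powPS-cong (suc k) F≋G = ⊛-cong F≋G (powPS-cong k F≋G)

  -- The quadratic equation

  -- F = 1 − a x F + γ x F², with the linear term moved across so that no subtraction occurs.
  ZEquation : Carrier → Carrier → PS → Set ℓ
  ZEquation a γ F = F ⊕ a · X* F ≋ one ⊕ γ · X* (F ⊛ F)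

  ZEquationIn : PS → Carrier → Carrier → PS → Set ℓ
  ZEquationIn y a γ F = F ⊕ const a ⊛ (y ⊛ F) ≋ one ⊕ const γ ⊛ (y ⊛ (F ⊛ F))

  ZEquation-cong : ∀ {a a′ γ γ′ F F′} → a ≈ a′ → γ ≈ γ′ → F ≋ F′ → ZEquation a γ F → ZEquation a′ γ′ F′
  ZEquation-cong a≈a′ γ≈γ′ F≋F′ eq = ≋-trans (⊕-cong (≋-sym F≋F′) (·-cong (sym a≈a′) (X*-cong (≋-sym F≋F′))))
    (≋-trans eq (⊕-cong ≋-refl (·-cong γ≈γ′ (X*-cong (⊛-cong F≋F′ F≋F′)))))

  ZEquation⇒ZEquationIn-X : ∀ {a γ F} → ZEquation a γ F → ZEquationIn X a γ F
  ZEquation⇒ZEquationIn-X {a} {γ} {F} eq =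
    ≋-trans (⊕-cong ≋-refl (≋-sym (·X*≋const⊛X⊛ a F))) (≋-trans eq (⊕-cong ≋-refl (·X*≋const⊛X⊛ γ (F ⊛ F))))

  ZEquationIn-X⇒ZEquation : ∀ {a γ F} → ZEquationIn X a γ F → ZEquation a γ F
  ZEquationIn-X⇒ZEquation {a} {γ} {F} eq =
    ≋-trans (⊕-cong ≋-refl (·X*≋const⊛X⊛ a F)) (≋-trans eq (⊕-cong ≋-refl (≋-sym (·X*≋const⊛X⊛ γ (F ⊛ F)))))

  ZEquation-unique : ∀ {a γ F G} → ZEquation a γ F → ZEquation a γ G → F ≋ G
  ZEquation-unique {a} {γ} {F} {G} eqF eqG n = <-rec (λ n → F n ≈ G n) step n
    where
    step : ∀ n → (∀ {i} → i < n → F i ≈ G i) → F n ≈ G n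
    step zero    _  = +-cancelʳ (a * 0#) (F 0) (G 0) (trans (eqF 0) (sym (eqG 0)))
    step (suc n) ih = +-cancelʳ (a * F n) (F (suc n)) (G (suc n)) (begin
      F (suc n) + a * F n                   ≈⟨ eqF (suc n) ⟩
      0# + γ * (F ⊛ F) n                    ≈⟨ +-congˡ (*-congˡ (⊛-cong-≤ n below below)) ⟩
      0# + γ * (G ⊛ G) n                    ≈⟨ eqG (suc n) ⟨
      G (suc n) + a * G n                   ≈⟨ +-congˡ (*-congˡ (ih (ℕ.n<1+n n))) ⟨
      G (suc n) + a * F n                   ∎)
      where
      open ≈-Reasoning
      below : ∀ i → i ≤ n → F i ≈ G i
      below i i≤n = ih (s≤s i≤n)

  ZEquation⇒equation : ∀ {a γ F} → ZEquation a γ F → F ≋ one ⊖ a · X* F ⊕ γ · X* (F ⊛ F)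
  ZEquation⇒equation {a} {γ} {F} eq n = begin
    F n                                     ≈⟨ +-identityʳ (F n) ⟨
    F n + 0#                                ≈⟨ +-congˡ (-‿inverseʳ u) ⟨
    F n + (u - u)                           ≈⟨ +-assoc (F n) u (- u) ⟨
    F n + u - u                             ≈⟨ +-congʳ (eq n) ⟩
    one n + v - u                           ≈⟨ solve 3 (λ o v m → o :+ v :+ m := o :+ m :+ v) refl (one n) v (- u) ⟩
    one n - u + v                           ∎
    where
    open ≈-Reasoning
    open ≈-Solver
    u = (a · X* F) n
    v = (γ · X* (F ⊛ F)) n

  ZEquation-one : ∀ a → ZEquation a a one
  ZEquation-one a = ZEquationIn-X⇒ZEquation (solve 2 (λ A x → con 1 :+ A :* (x :* con 1) := con 1 :+ A :* (x :* (con 1 :* con 1))) ≋-refl (const a) X)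
    where open ≋-Solver

  -- Substitution

  ∘ₛ-congˡ : ∀ {F F′} G → F ≋ F′ → F ∘ₛ G ≋ F′ ∘ₛ G
  ∘ₛ-congˡ G F≋F′ n = sumTo-cong (suc n) (λ k → *-congʳ (F≋F′ k))

  ∘ₛ-distribʳ-⊕ : ∀ G F H → (F ⊕ H) ∘ₛ G ≋ F ∘ₛ G ⊕ H ∘ₛ G
  ∘ₛ-distribʳ-⊕ G F H n = trans (sumTo-cong (suc n) (λ k → distribʳ _ _ _)) (sumTo-+ (suc n) _ _)

  ·-∘ₛ : ∀ r F G → (r · F) ∘ₛ G ≋ r · (F ∘ₛ G)
  ·-∘ₛ r F G n = trans (sumTo-cong (suc n) (λ k → *-assoc _ _ _)) (sym (*-distribˡ-sumTo (suc n) r _))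

  0ₛ-∘ₛ : ∀ G → 0ₛ ∘ₛ G ≋ 0ₛ
  0ₛ-∘ₛ G n = sumTo-0 (suc n) (λ k _ → zeroˡ _)

  module Composition {G : PS} (G₀≈0 : G 0 ≈ 0#) where

    powPS-vanishes : ∀ k n → n < k → powPS G k n ≈ 0#
    powPS-vanishes (suc k) n n<1+k = begin
      (G ⊛ powPS G k) n                                                   ≈⟨ sumTo-unconsˡ n _ ⟩
      G 0 * powPS G k n + sumTo n (λ i → G (suc i) * powPS G k (n ℕ.∸ suc i)) ≈⟨ +-cong (trans (*-congʳ G₀≈0) (zeroˡ _)) (sumTo-0 n later) ⟩
      0# + 0#                                                             ≈⟨ +-identityʳ 0# ⟩
      0#                                                                  ∎
      where
      open ≈-Reasoning
      later : ∀ i → i < n → G (suc i) * powPS G k (n ℕ.∸ suc i) ≈ 0#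
      later i i<n = trans (*-congˡ (powPS-vanishes k _ (ℕ.<-≤-trans (ℕ.∸-monoʳ-< (s≤s z≤n) i<n) (ℕ.≤-pred n<1+k)))) (zeroʳ _)

    ∘ₛ-as-sumTo : ∀ F n N → n < N → (F ∘ₛ G) n ≈ sumTo N (λ k → F k * powPS G k n)
    ∘ₛ-as-sumTo F n N n<N = sumTo-extend n<N (λ k n<k → trans (*-congˡ (powPS-vanishes k n n<k)) (zeroʳ _))

    ⊛-∘ₛ : ∀ H F n → (H ⊛ (F ∘ₛ G)) n ≈ sumTo (suc n) (λ k → F k * (H ⊛ powPS G k) n)
    ⊛-∘ₛ H F n = begin
      sumTo (suc n) (λ i → H i * (F ∘ₛ G) (n ℕ.∸ i))
        ≈⟨ sumTo-cong (suc n) (λ i → *-congˡ (∘ₛ-as-sumTo F (n ℕ.∸ i) (suc n) (s≤s (ℕ.m∸n≤m n i)))) ⟩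
      sumTo (suc n) (λ i → H i * sumTo (suc n) (λ k → F k * powPS G k (n ℕ.∸ i)))
        ≈⟨ sumTo-cong (suc n) (λ i → *-distribˡ-sumTo (suc n) (H i) _) ⟩
      sumTo (suc n) (λ i → sumTo (suc n) (λ k → H i * (F k * powPS G k (n ℕ.∸ i))))
        ≈⟨ sumTo-swap (suc n) (suc n) _ ⟩
      sumTo (suc n) (λ k → sumTo (suc n) (λ i → H i * (F k * powPS G k (n ℕ.∸ i))))
        ≈⟨ sumTo-cong (suc n) (λ k → sumTo-cong (suc n) (λ i → x∙yz≈y∙xz (H i) (F k) _)) ⟩
      sumTo (suc n) (λ k → sumTo (suc n) (λ i → F k * (H i * powPS G k (n ℕ.∸ i))))
        ≈⟨ sumTo-cong (suc n) (λ k → *-distribˡ-sumTo (suc n) (F k) _) ⟨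
      sumTo (suc n) (λ k → F k * (H ⊛ powPS G k) n) ∎
      where open ≈-Reasoning

    ∘ₛ-horner : ∀ F → F ∘ₛ G ≋ const (F 0) ⊕ G ⊛ (tail F ∘ₛ G)
    ∘ₛ-horner F n = begin
      sumTo (suc n) (λ k → F k * powPS G k n)                        ≈⟨ sumTo-unconsˡ n _ ⟩
      F 0 * one n + sumTo n (λ k → F (suc k) * powPS G (suc k) n)    ≈⟨ +-cong (·-one (F 0) n) (sumTo-extend (ℕ.n≤1+n n) top-vanishes) ⟩
      const (F 0) n + sumTo (suc n) (λ k → F (suc k) * (G ⊛ powPS G k) n)
                                                                     ≈⟨ +-congˡ (⊛-∘ₛ G (tail F) n) ⟨
      const (F 0) n + (G ⊛ (tail F ∘ₛ G)) n                          ∎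
      where
      open ≈-Reasoning
      top-vanishes : ∀ k → n ≤ k → F (suc k) * powPS G (suc k) n ≈ 0#
      top-vanishes k n≤k = trans (*-congˡ (powPS-vanishes (suc k) n (s≤s n≤k))) (zeroʳ _)

    const-∘ₛ : ∀ r → const r ∘ₛ G ≋ const r
    const-∘ₛ r n = begin
      (const r ∘ₛ G) n                  ≈⟨ ∘ₛ-horner (const r) n ⟩
      const r n + (G ⊛ (0ₛ ∘ₛ G)) n     ≈⟨ +-congˡ (trans (⊛-cong ≋-refl (0ₛ-∘ₛ G) n) (trans (⊛-comm G 0ₛ n) (⊛-zeroˡ G n))) ⟩
      const r n + 0#                    ≈⟨ +-identityʳ _ ⟩
      const r n                         ∎
      where open ≈-Reasoning

    X-∘ₛ : X ∘ₛ G ≋ G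
    X-∘ₛ n = begin
      (X ∘ₛ G) n                        ≈⟨ ∘ₛ-horner X n ⟩
      const 0# n + (G ⊛ (one ∘ₛ G)) n   ≈⟨ +-cong (const-0# n) (⊛-cong ≋-refl (const-∘ₛ 1#) n) ⟩
      0# + (G ⊛ one) n                  ≈⟨ +-identityˡ _ ⟩
      (G ⊛ one) n                       ≈⟨ trans (⊛-comm G one n) (⊛-identityˡ G n) ⟩
      G n                               ∎
      where open ≈-Reasoning

    G⊛-cong-< : ∀ n {A B} → (∀ i → i < n → A i ≈ B i) → (G ⊛ A) n ≈ (G ⊛ B) n
    G⊛-cong-< n {A} {B} A≈B = begin
      (G ⊛ A) n                                                ≈⟨ sumTo-unconsˡ n _ ⟩
      G 0 * A n + sumTo n (λ i → G (suc i) * A (n ℕ.∸ suc i))  ≈⟨ +-cong (trans (*-congʳ G₀≈0) (trans (zeroˡ _) (sym (zeroˡ _))))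
                                                                     (sumTo-cong< n (λ i i<n → *-congˡ (A≈B _ (ℕ.∸-monoʳ-< (s≤s z≤n) i<n)))) ⟩
      0# * B n + sumTo n (λ i → G (suc i) * B (n ℕ.∸ suc i))   ≈⟨ +-congʳ (*-congʳ G₀≈0) ⟨
      G 0 * B n + sumTo n (λ i → G (suc i) * B (n ℕ.∸ suc i))  ≈⟨ sumTo-unconsˡ n _ ⟨
      (G ⊛ B) n                                                ∎
      where open ≈-Reasoning

    ∘ₛ-horner-⊛ : ∀ F H → (F ∘ₛ G) ⊛ (H ∘ₛ G) ≋ const (F 0 * H 0) ⊕ G ⊛ (F 0 · (tail H ∘ₛ G) ⊕ (tail F ∘ₛ G) ⊛ (H ∘ₛ G))
    ∘ₛ-horner-⊛ F H = begin
      (F ∘ₛ G) ⊛ HG                                         ≈⟨ ⊛-cong {G = HG} (∘ₛ-horner F) ≋-refl ⟩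
      (const (F 0) ⊕ G ⊛ p) ⊛ HG                            ≈⟨ solve 4 (λ f g p h → (f :+ g :* p) :* h := f :* h :+ g :* (p :* h)) ≋-refl (const (F 0)) G p HG ⟩
      const (F 0) ⊛ HG ⊕ G ⊛ (p ⊛ HG)                       ≈⟨ ⊕-cong {G = G ⊛ (p ⊛ HG)} (⊛-cong {F = const (F 0)} ≋-refl (∘ₛ-horner H)) ≋-refl ⟩
      const (F 0) ⊛ (const (H 0) ⊕ G ⊛ q) ⊕ G ⊛ (p ⊛ HG)    ≈⟨ solve 6 (λ f h g p q w → f :* (h :+ g :* q) :+ g :* (p :* w) := f :* h :+ g :* (f :* q :+ p :* w))
                                                                ≋-refl (const (F 0)) (const (H 0)) G p q HG ⟩
      const (F 0) ⊛ const (H 0) ⊕ G ⊛ (const (F 0) ⊛ q ⊕ p ⊛ HG)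
                                                            ≈⟨ ⊕-cong (≋-sym (const-* (F 0) (H 0))) (⊛-cong {F = G} ≋-refl (⊕-cong {G = p ⊛ HG} (const-⊛ (F 0) q) ≋-refl)) ⟩
      const (F 0 * H 0) ⊕ G ⊛ (F 0 · q ⊕ p ⊛ HG)            ∎
      where
      open ≋-Reasoning
      open ≋-Solver
      p = tail F ∘ₛ G
      q = tail H ∘ₛ G
      HG = H ∘ₛ G


    ∘ₛ-⊛ : ∀ F H → (F ⊛ H) ∘ₛ G ≋ (F ∘ₛ G) ⊛ (H ∘ₛ G)
    ∘ₛ-⊛ F H n = <-rec Multiplicative step n F H
      where
      Multiplicative : ℕ → Set (c ⊔ ℓ)
      Multiplicative n = ∀ F H → ((F ⊛ H) ∘ₛ G) n ≈ ((F ∘ₛ G) ⊛ (H ∘ₛ G)) n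

      step : ∀ n → (∀ {i} → i < n → Multiplicative i) → Multiplicative n
      step n ih F H = begin
        ((F ⊛ H) ∘ₛ G) n                                   ≈⟨ ∘ₛ-horner (F ⊛ H) n ⟩
        const ((F ⊛ H) 0) n + (G ⊛ (tail (F ⊛ H) ∘ₛ G)) n  ≈⟨ +-cong (const-cong (+-identityˡ _) n) (G⊛-cong-< n tail-∘ₛ) ⟩
        (const (F 0 * H 0) ⊕ G ⊛ (F 0 · q ⊕ p ⊛ HG)) n     ≈⟨ ∘ₛ-horner-⊛ F H n ⟨
        ((F ∘ₛ G) ⊛ HG) n                                  ∎
        where
        open ≈-Reasoning
        p = tail F ∘ₛ G
        q = tail H ∘ₛ G
        HG = H ∘ₛ G
        tail-∘ₛ : ∀ i → i < n → (tail (F ⊛ H) ∘ₛ G) i ≈ (F 0 · q ⊕ p ⊛ HG) i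
        tail-∘ₛ i i<n = begin
          (tail (F ⊛ H) ∘ₛ G) i                     ≈⟨ ∘ₛ-congˡ G (tail-⊛ F H) i ⟩
          ((F 0 · tail H ⊕ tail F ⊛ H) ∘ₛ G) i      ≈⟨ ∘ₛ-distribʳ-⊕ G _ _ i ⟩
          ((F 0 · tail H) ∘ₛ G) i + ((tail F ⊛ H) ∘ₛ G) i ≈⟨ +-cong (·-∘ₛ (F 0) (tail H) G i) (ih i<n (tail F) H) ⟩
          (F 0 · q ⊕ p ⊛ HG) i                      ∎

    ZEquationIn-∘ₛ : ∀ {a γ V} → ZEquationIn X a γ V → ZEquationIn G a γ (V ∘ₛ G)
    ZEquationIn-∘ₛ {a} {γ} {V} eqV = begin
      W ⊕ A ⊛ (G ⊛ W)                               ≈⟨ ⊕-cong {F = W} ≋-refl (⊛-cong (≋-sym (const-∘ₛ a)) (⊛-cong {G = W} (≋-sym X-∘ₛ) ≋-refl)) ⟩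
      W ⊕ (A ∘ₛ G) ⊛ ((X ∘ₛ G) ⊛ W)                 ≈⟨ ⊕-cong {F = W} ≋-refl (≋-trans (∘ₛ-⊛ A (X ⊛ V)) (⊛-cong {F = A ∘ₛ G} ≋-refl (∘ₛ-⊛ X V))) ⟨
      W ⊕ (A ⊛ (X ⊛ V)) ∘ₛ G                        ≈⟨ ∘ₛ-distribʳ-⊕ G V _ ⟨
      (V ⊕ A ⊛ (X ⊛ V)) ∘ₛ G                        ≈⟨ ∘ₛ-congˡ G eqV ⟩
      (one ⊕ Γ ⊛ (X ⊛ (V ⊛ V))) ∘ₛ G                ≈⟨ ∘ₛ-distribʳ-⊕ G one _ ⟩
      one ∘ₛ G ⊕ (Γ ⊛ (X ⊛ (V ⊛ V))) ∘ₛ G            ≈⟨ ⊕-cong (const-∘ₛ 1#) (≋-trans (∘ₛ-⊛ Γ _) (⊛-cong (const-∘ₛ γ) (≋-trans (∘ₛ-⊛ X _) (⊛-cong X-∘ₛ (∘ₛ-⊛ V V))))) ⟩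
      one ⊕ Γ ⊛ (G ⊛ (W ⊛ W))                       ∎
      where
      open ≋-Reasoning
      A = const a
      Γ = const γ
      W = V ∘ₛ G

  graft : PS → Carrier → PS → PS
  graft T k V = T ⊛ (V ∘ₛ (k · X* (T ⊛ T)))

  -- With y = k x T² and W = V(y) one has γ x T² = a′ y, hence
  -- (T W)(1 + a x) = W (1 + γ x T²) = W (1 + a′ y) = 1 + γ′ y W² = 1 + γ′ k x (T W)².
  graft-ZEquation : ∀ {a γ a′ γ′ k T V} → ZEquation a γ T → ZEquation a′ γ′ V → a′ * k ≈ γ →
    ZEquation a (γ′ * k) (graft T k V)
  graft-ZEquation {a} {γ} {a′} {γ′} {k} {T} {V} eqT eqV a′k≈γ = ZEquationIn-X⇒ZEquation (begin
    U ⊕ A ⊛ (X ⊛ U)                         ≈⟨ solve 4 (λ T W A x → T :* W :+ A :* (x :* (T :* W)) := W :* (T :+ A :* (x :* T))) ≋-refl T W A X ⟩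
    W ⊛ (T ⊕ A ⊛ (X ⊛ T))                   ≈⟨ ⊛-cong {F = W} ≋-refl (ZEquation⇒ZEquationIn-X eqT) ⟩
    W ⊛ (one ⊕ const γ ⊛ (X ⊛ (T ⊛ T)))     ≈⟨ ⊛-cong {F = W} ≋-refl (⊕-cong {F = one} ≋-refl (⊛-cong {G = X ⊛ (T ⊛ T)} (≋-trans (const-cong (sym a′k≈γ)) (const-* a′ k)) ≋-refl)) ⟩
    W ⊛ (one ⊕ (A′ ⊛ K) ⊛ (X ⊛ (T ⊛ T)))    ≈⟨ solve 5 (λ W A′ K x T → W :* (con 1 :+ (A′ :* K) :* (x :* (T :* T))) := W :+ A′ :* ((K :* (x :* (T :* T))) :* W)) ≋-refl W A′ K X T ⟩
    W ⊕ A′ ⊛ (y′ ⊛ W)                       ≈⟨ ⊕-cong {F = W} ≋-refl (⊛-cong {F = A′} ≋-refl (⊛-cong {G = W} (≋-sym y≋y′) ≋-refl)) ⟩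
    W ⊕ A′ ⊛ (y ⊛ W)                        ≈⟨ Composition.ZEquationIn-∘ₛ (zeroʳ k) (ZEquation⇒ZEquationIn-X eqV) ⟩
    one ⊕ Γ′ ⊛ (y ⊛ (W ⊛ W))                ≈⟨ ⊕-cong {F = one} ≋-refl (⊛-cong {F = Γ′} ≋-refl (⊛-cong {G = W ⊛ W} y≋y′ ≋-refl)) ⟩
    one ⊕ Γ′ ⊛ (y′ ⊛ (W ⊛ W))               ≈⟨ solve 5 (λ Γ′ K x T W → con 1 :+ Γ′ :* ((K :* (x :* (T :* T))) :* (W :* W)) := con 1 :+ (Γ′ :* K) :* (x :* ((T :* W) :* (T :* W)))) ≋-refl Γ′ K X T W ⟩
    one ⊕ (Γ′ ⊛ K) ⊛ (X ⊛ (U ⊛ U))          ≈⟨ ⊕-cong {F = one} ≋-refl (⊛-cong {G = X ⊛ (U ⊛ U)} (≋-sym (const-* γ′ k)) ≋-refl) ⟩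
    one ⊕ const (γ′ * k) ⊛ (X ⊛ (U ⊛ U))    ∎)
    where
    open ≋-Reasoning
    open ≋-Solver
    A = const a
    A′ = const a′
    Γ′ = const γ′
    K = const k
    y = k · X* (T ⊛ T)
    y′ = K ⊛ (X ⊛ (T ⊛ T))
    W = V ∘ₛ y
    U = T ⊛ W
    y≋y′ : y ≋ y′
    y≋y′ = ·X*≋const⊛X⊛ k (T ⊛ T)

  -- The series S

  ballotPS : ℕ → PS
  ballotPS h j = fromℕ (ballot j h)

  ballotPS-suc : ∀ h → ballotPS (suc h) ≋ ballotPS 0 ⊛ ballotPS h
  ballotPS-suc h zero = begin
    1# + 0#                      ≈⟨ *-identityʳ _ ⟨
    (1# + 0#) * 1#               ≈⟨ *-congˡ (+-identityʳ 1#) ⟨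
    (1# + 0#) * (1# + 0#)        ≈⟨ +-identityˡ _ ⟨
    0# + (1# + 0#) * (1# + 0#)   ∎
    where open ≈-Reasoning
  ballotPS-suc zero (suc j) = begin
    fromℕ (ballot (suc j) 0 ℕ.+ ballot j 2)                  ≈⟨ fromℕ-+ (ballot (suc j) 0) (ballot j 2) ⟩
    ballotPS 0 (suc j) + ballotPS 2 j                        ≈⟨ +-comm _ _ ⟩
    ballotPS 2 j + ballotPS 0 (suc j)                        ≈⟨ +-cong (ballotPS-suc 1 j) (sym (*-identityʳ _)) ⟩
    (ballotPS 0 ⊛ ballotPS 1) j + ballotPS 0 (suc j) * 1#    ≈⟨ +-cong (sumTo-cong< (suc j) (λ m m<1+j → *-congˡ (reflexive (shift (ℕ.≤-pred m<1+j)))))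
                                                                       (*-congˡ (trans (sym (+-identityʳ 1#)) (reflexive (≡.cong (ballotPS 0) (≡.sym (ℕ.n∸n≡0 j)))))) ⟩
    (ballotPS 0 ⊛ ballotPS 0) (suc j)                        ∎
    where
    open ≈-Reasoning
    shift : ∀ {m} → m ≤ j → ballotPS 1 (j ℕ.∸ m) ≡ ballotPS 0 (suc j ℕ.∸ m)
    shift m≤j = ≡.cong (ballotPS 0) (≡.sym (ℕ.+-∸-assoc 1 m≤j))
  ballotPS-suc (suc h) (suc j) = begin
    fromℕ (ballot (suc j) (suc h) ℕ.+ ballot j (3 ℕ.+ h))    ≈⟨ fromℕ-+ (ballot (suc j) (suc h)) (ballot j (3 ℕ.+ h)) ⟩
    ballotPS (suc h) (suc j) + ballotPS (3 ℕ.+ h) j          ≈⟨ +-cong (ballotPS-suc h (suc j)) (ballotPS-suc (2 ℕ.+ h) j) ⟩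
    (sumTo (suc j) A + ballotPS 0 (suc j) * ballotPS h (j ℕ.∸ j)) + sumTo (suc j) B
                                                             ≈⟨ solve 3 (λ a x b → (a :+ x) :+ b := (a :+ b) :+ x) refl (sumTo (suc j) A) _ (sumTo (suc j) B) ⟩
    (sumTo (suc j) A + sumTo (suc j) B) + ballotPS 0 (suc j) * ballotPS h (j ℕ.∸ j)
                                                             ≈⟨ +-cong (sym (sumTo-+ (suc j) A B)) (*-congˡ (reflexive last)) ⟩
    sumTo (suc j) (λ m → A m + B m) + ballotPS 0 (suc j) * ballotPS (suc h) (j ℕ.∸ j)
                                                             ≈⟨ +-congʳ (sumTo-cong< (suc j) (λ m m<1+j → term m (ℕ.≤-pred m<1+j))) ⟩
    (ballotPS 0 ⊛ ballotPS (suc h)) (suc j)                  ∎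
    where
    open ≈-Reasoning
    open ≈-Solver
    A = λ m → ballotPS 0 m * ballotPS h (suc j ℕ.∸ m)
    B = λ m → ballotPS 0 m * ballotPS (2 ℕ.+ h) (j ℕ.∸ m)
    last : ballotPS h (j ℕ.∸ j) ≡ ballotPS (suc h) (j ℕ.∸ j)
    last rewrite ℕ.n∸n≡0 j = ≡.refl
    term : ∀ m → m ≤ j → A m + B m ≈ ballotPS 0 m * ballotPS (suc h) (suc j ℕ.∸ m)
    term m m≤j rewrite ℕ.+-∸-assoc 1 m≤j = begin
      ballotPS 0 m * ballotPS h (suc (j ℕ.∸ m)) + ballotPS 0 m * ballotPS (2 ℕ.+ h) (j ℕ.∸ m)
                                                                  ≈⟨ distribˡ _ _ _ ⟨
      ballotPS 0 m * (ballotPS h (suc (j ℕ.∸ m)) + ballotPS (2 ℕ.+ h) (j ℕ.∸ m))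
                                                                  ≈⟨ *-congˡ (fromℕ-+ (ballot (suc (j ℕ.∸ m)) h) _) ⟨
      ballotPS 0 m * ballotPS (suc h) (suc (j ℕ.∸ m))             ∎

  catalanPS : PS
  catalanPS k = fromℕ (catalan k)

  catalanPS-ZEquation : ZEquation 0# 1# catalanPS
  catalanPS-ZEquation zero    = +-cong (+-identityʳ 1#) (trans (zeroˡ _) (sym (zeroʳ _)))
  catalanPS-ZEquation (suc n) = begin
    catalanPS (suc n) + 0# * catalanPS n      ≈⟨ +-congˡ (zeroˡ _) ⟩
    catalanPS (suc n) + 0#                    ≈⟨ +-identityʳ _ ⟩
    catalanPS (suc n)                         ≈⟨ catalanPS≋ballotPS (suc n) ⟩
    ballotPS 1 n                              ≈⟨ ballotPS-suc 0 n ⟩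
    (ballotPS 0 ⊛ ballotPS 0) n               ≈⟨ ⊛-cong catalanPS≋ballotPS catalanPS≋ballotPS n ⟨
    (catalanPS ⊛ catalanPS) n                 ≈⟨ *-identityˡ _ ⟨
    1# * (catalanPS ⊛ catalanPS) n            ≈⟨ +-identityˡ _ ⟨
    0# + 1# * (catalanPS ⊛ catalanPS) n       ∎
    where
    open ≈-Reasoning
    catalanPS≋ballotPS : catalanPS ≋ ballotPS 0
    catalanPS≋ballotPS k = reflexive (≡.cong fromℕ (catalan≡ballot k))

  geometric : Carrier → PS
  geometric α n = pow α n

  geometric-equation : ∀ α → geometric α ≋ one ⊕ α · X* (geometric α)
  geometric-equation α zero    = sym (trans (+-congˡ (zeroʳ α)) (+-identityʳ 1#))
  geometric-equation α (suc n) = sym (+-identityˡ _)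

  geometric-ZEquation : ∀ α → ZEquation (- α) 0# (geometric α)
  geometric-ZEquation α n = begin
    geometric α n + - α * u              ≈⟨ +-congʳ (geometric-equation α n) ⟩
    one n + α * u + - α * u              ≈⟨ +-assoc _ _ _ ⟩
    one n + (α * u + - α * u)            ≈⟨ +-congˡ (trans (sym (distribʳ u α (- α))) (trans (*-congʳ (-‿inverseʳ α)) (zeroˡ u))) ⟩
    one n + 0#                           ≈⟨ +-congˡ (zeroˡ _) ⟨
    one n + 0# * X* (geometric α ⊛ geometric α) n ∎
    where
    open ≈-Reasoning
    u = X* (geometric α) n

  geometric-⊛ : ∀ α F → geometric α ⊛ F ≋ F ⊕ α · X* (geometric α ⊛ F)
  geometric-⊛ α F = begin
    P ⊛ F                                ≈⟨ ⊛-cong {G = F} (≋-trans (geometric-equation α) (⊕-cong {F = one} ≋-refl (·X*≋const⊛X⊛ α P))) ≋-refl ⟩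
    (one ⊕ const α ⊛ (X ⊛ P)) ⊛ F        ≈⟨ solve 4 (λ P F A x → (con 1 :+ A :* (x :* P)) :* F := F :+ A :* (x :* (P :* F))) ≋-refl P F (const α) X ⟩
    F ⊕ const α ⊛ (X ⊛ (P ⊛ F))          ≈⟨ ⊕-cong {F = F} ≋-refl (·X*≋const⊛X⊛ α (P ⊛ F)) ⟨
    F ⊕ α · X* (P ⊛ F)                   ∎
    where
    open ≋-Reasoning
    open ≋-Solver
    P = geometric α

  linear-unique : ∀ α {V Y Y′} → Y ≋ V ⊕ α · X* Y → Y′ ≋ V ⊕ α · X* Y′ → Y ≋ Y′
  linear-unique α eqY eqY′ zero    = trans (eqY 0) (sym (eqY′ 0))
  linear-unique α eqY eqY′ (suc n) = trans (eqY (suc n)) (trans (+-congˡ (*-congˡ (linear-unique α eqY eqY′ n))) (sym (eqY′ (suc n))))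

  binomialPS : Carrier → ℕ → PS
  binomialPS α m j = fromℕ ((m ℕ.+ j) C j) * pow α j

  binomialPS-equation : ∀ α m → binomialPS α (suc m) ≋ binomialPS α m ⊕ α · X* (binomialPS α (suc m))
  binomialPS-equation α m zero    = sym (trans (+-congˡ (zeroʳ α)) (+-identityʳ _))
  binomialPS-equation α m (suc j) = begin
    fromℕ ((suc m ℕ.+ suc j) C suc j) * (α * pow α j)       ≈⟨ *-congʳ (reflexive (≡.cong fromℕ (pascal (m ℕ.+ suc j) j))) ⟩
    fromℕ (N₁ ℕ.+ N₂) * (α * pow α j)                        ≈⟨ *-congʳ (fromℕ-+ N₁ N₂) ⟩
    (fromℕ N₁ + fromℕ N₂) * (α * pow α j)                    ≈⟨ solve 4 (λ u v a p → (u :+ v) :* (a :* p) := v :* (a :* p) :+ a :* (u :* p)) refl (fromℕ N₁) (fromℕ N₂) α (pow α j) ⟩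
    fromℕ N₂ * (α * pow α j) + α * (fromℕ N₁ * pow α j)      ≈⟨ +-congˡ (*-congˡ (*-congʳ (reflexive (≡.cong (λ i → fromℕ (i C j)) (ℕ.+-suc m j))))) ⟩
    binomialPS α m (suc j) + α * binomialPS α (suc m) j      ∎
    where
    open ≈-Reasoning
    open ≈-Solver
    N₁ = (m ℕ.+ suc j) C j
    N₂ = (m ℕ.+ suc j) C suc j

  powPS-geometric : ∀ α m → powPS (geometric α) (suc m) ≋ binomialPS α m
  powPS-geometric α zero    j = trans (trans (⊛-comm (geometric α) one j) (⊛-identityˡ (geometric α) j))
    (sym (trans (*-congʳ (trans (reflexive (≡.cong fromℕ (nCn≡1 j))) (+-identityʳ 1#))) (*-identityˡ _)))
  powPS-geometric α (suc m) = ≋-trans (⊛-cong {F = geometric α} ≋-refl (powPS-geometric α m))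
    (linear-unique α (geometric-⊛ α (binomialPS α m)) (binomialPS-equation α m))

  powPS-⊛ : ∀ F G k → powPS (F ⊛ G) k ≋ powPS F k ⊛ powPS G k
  powPS-⊛ F G k rewrite powPS≡^ₛ (F ⊛ G) k | powPS≡^ₛ F k | powPS≡^ₛ G k = ^ₛ-distrib-⊛ F G k

  powPS-+ : ∀ F m n → powPS F (m ℕ.+ n) ≋ powPS F m ⊛ powPS F n
  powPS-+ F m n rewrite powPS≡^ₛ F (m ℕ.+ n) | powPS≡^ₛ F m | powPS≡^ₛ F n = ^ₛ-homo-⊛ F m n

  powPS-const : ∀ r k → powPS (const r) k ≋ const (pow r k)
  powPS-const r zero    = ≋-refl
  powPS-const r (suc k) = ≋-trans (⊛-cong {F = const r} ≋-refl (powPS-const r k)) (≋-sym (const-* r (pow r k)))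

  powPS-X-shift : ∀ k j F → (powPS X k ⊛ F) (k ℕ.+ j) ≈ F j
  powPS-X-shift zero    j F = ⊛-identityˡ F j
  powPS-X-shift (suc k) j F =
    trans (⊛-assoc X (powPS X k) F (suc (k ℕ.+ j))) (trans (sym (X*≋X⊛ (powPS X k ⊛ F) (suc (k ℕ.+ j)))) (powPS-X-shift k j F))

  geometric-⊛-powPS : ∀ α β k → let P = geometric α in
    P ⊛ powPS (β · X* (P ⊛ P)) k ≋ const (pow β k) ⊛ (powPS X k ⊛ powPS P (suc (2 ℕ.* k)))
  geometric-⊛-powPS α β k = begin
    P ⊛ powPS (β · X* (P ⊛ P)) k                              ≈⟨ ⊛-cong {F = P} ≋-refl (powPS-cong k (·X*≋const⊛X⊛ β (P ⊛ P))) ⟩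
    P ⊛ powPS (const β ⊛ (X ⊛ (P ⊛ P))) k                     ≈⟨ ⊛-cong {F = P} ≋-refl (≋-trans (powPS-⊛ _ _ k) (⊛-cong (powPS-const β k)
                                                                   (≋-trans (powPS-⊛ X _ k) (⊛-cong {F = powPS X k} ≋-refl (powPS-⊛ P P k))))) ⟩
    P ⊛ (const (pow β k) ⊛ (powPS X k ⊛ (Pᵏ ⊛ Pᵏ)))             ≈⟨ solve 4 (λ P B x p → P :* (B :* (x :* (p :* p))) := B :* (x :* (P :* (p :* p)))) ≋-refl P (const (pow β k)) (powPS X k) Pᵏ ⟩
    const (pow β k) ⊛ (powPS X k ⊛ (P ⊛ (Pᵏ ⊛ Pᵏ)))             ≈⟨ ⊛-cong {F = const (pow β k)} ≋-refl (⊛-cong {F = powPS X k} ≋-refl (⊛-cong {F = P} ≋-refl double)) ⟩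
    const (pow β k) ⊛ (powPS X k ⊛ powPS P (suc (2 ℕ.* k)))   ∎
    where
    open ≋-Reasoning
    open ≋-Solver
    P = geometric α
    Pᵏ = powPS P k
    double : Pᵏ ⊛ Pᵏ ≋ powPS P (2 ℕ.* k)
    double rewrite ℕ.+-identityʳ k = ≋-sym (powPS-+ P k k)

  -- Expanded, S(α,β;x) = Σₖ Cₖ βᵏ xᵏ (1 − α x)^−(2k+1), and [xⁿ] xᵏ (1 − α x)^−(2k+1) = binom(n+k, 2k) α^(n−k).
  S-as-graft : ∀ α β → S α β ≋ graft (geometric α) β catalanPS
  S-as-graft α β n = sym (trans (⊛-∘ₛ P catalanPS n) (sumTo-cong< (suc n) (λ k k<1+n → term k (ℕ.≤-pred k<1+n))))
    where
    P = geometric α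
    open Composition {β · X* (P ⊛ P)} (zeroʳ β)
    term : ∀ k → k ≤ n → catalanPS k * (P ⊛ powPS (β · X* (P ⊛ P)) k) n ≈
                        fromℕ (((n ℕ.+ k) C (2 ℕ.* k)) ℕ.* catalan k) * (pow α (n ℕ.∸ k) * pow β k)
    term k k≤n = begin
      catalanPS k * (P ⊛ powPS (β · X* (P ⊛ P)) k) n                       ≈⟨ *-congˡ (trans (geometric-⊛-powPS α β k n) (const-⊛ (pow β k) (powPS X k ⊛ powPS P (suc (2 ℕ.* k))) n)) ⟩
      catalanPS k * (pow β k * (powPS X k ⊛ powPS P (suc (2 ℕ.* k))) n)    ≈⟨ *-congˡ (*-congˡ (reflexive (≡.cong (powPS X k ⊛ powPS P (suc (2 ℕ.* k))) (≡.sym k+j≡n)))) ⟩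
      catalanPS k * (pow β k * (powPS X k ⊛ powPS P (suc (2 ℕ.* k))) (k ℕ.+ j))
                                                                           ≈⟨ *-congˡ (*-congˡ (trans (powPS-X-shift k j (powPS P (suc (2 ℕ.* k)))) (powPS-geometric α (2 ℕ.* k) j))) ⟩
      catalanPS k * (pow β k * (fromℕ ((2 ℕ.* k ℕ.+ j) C j) * pow α j))   ≈⟨ *-congˡ (*-congˡ (*-congʳ (reflexive (≡.cong fromℕ (C-diagonal k≤n))))) ⟩
      catalanPS k * (pow β k * (fromℕ ((n ℕ.+ k) C (2 ℕ.* k)) * pow α j)) ≈⟨ solve 4 (λ c q m p → c :* (q :* (m :* p)) := (m :* c) :* (p :* q)) refl (catalanPS k) (pow β k) (fromℕ ((n ℕ.+ k) C (2 ℕ.* k))) (pow α j) ⟩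
      fromℕ ((n ℕ.+ k) C (2 ℕ.* k)) * catalanPS k * (pow α j * pow β k)   ≈⟨ *-congʳ (fromℕ-* ((n ℕ.+ k) C (2 ℕ.* k)) (catalan k)) ⟨
      fromℕ (((n ℕ.+ k) C (2 ℕ.* k)) ℕ.* catalan k) * (pow α j * pow β k) ∎
      where
      open ≈-Reasoning
      open ≈-Solver
      j = n ℕ.∸ k
      k+j≡n : k ℕ.+ j ≡ n
      k+j≡n = ℕ.m+[n∸m]≡n k≤n

  S-ZEquation : ∀ α β → ZEquation (- α) β (S α β)
  S-ZEquation α β = ZEquation-cong refl (*-identityˡ β) (≋-sym (S-as-graft α β))
    (graft-ZEquation (geometric-ZEquation α) catalanPS-ZEquation (zeroˡ β))

  S-neg-ZEquation : ∀ a γ → ZEquation a γ (S (- a) γ)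
  S-neg-ZEquation a γ = ZEquation-cong (-‿involutive a) refl ≋-refl (S-ZEquation (- a) γ)

  pow-neg : ∀ x n → pow (- x) n ≈ pow (- 1#) n * pow x n
  pow-neg x n = trans (pow-cong n (sym (-1*x≈-x x))) (pow-* (- 1#) x n)

  negX-S : ∀ α β → negX (S α β) ≋ S (- α) (- β)
  negX-S α β n = trans (*-distribˡ-sumTo (suc n) _ _) (sumTo-cong< (suc n) (λ k k<1+n → term k (ℕ.≤-pred k<1+n)))
    where
    term : ∀ k → k ≤ n → let coeff = fromℕ (((n ℕ.+ k) C (2 ℕ.* k)) ℕ.* catalan k) in
      pow (- 1#) n * (coeff * (pow α (n ℕ.∸ k) * pow β k)) ≈ coeff * (pow (- α) (n ℕ.∸ k) * pow (- β) k)
    term k k≤n = begin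
      pow (- 1#) n * (coeff * (pow α j * pow β k))                       ≈⟨ *-congʳ (reflexive (≡.cong (pow (- 1#)) (≡.sym (ℕ.m∸n+n≡m k≤n)))) ⟩
      pow (- 1#) (j ℕ.+ k) * (coeff * (pow α j * pow β k))               ≈⟨ *-congʳ (pow-+ (- 1#) j k) ⟩
      pow (- 1#) j * pow (- 1#) k * (coeff * (pow α j * pow β k))        ≈⟨ solve 5 (λ u v c p q → u :* v :* (c :* (p :* q)) := c :* ((u :* p) :* (v :* q))) refl (pow (- 1#) j) (pow (- 1#) k) coeff (pow α j) (pow β k) ⟩
      coeff * (pow (- 1#) j * pow α j * (pow (- 1#) k * pow β k))        ≈⟨ *-congˡ (*-cong (pow-neg α j) (pow-neg β k)) ⟨
      coeff * (pow (- α) j * pow (- β) k)                                ∎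
      where
      open ≈-Reasoning
      open ≈-Solver
      j = n ℕ.∸ k
      coeff = fromℕ (((n ℕ.+ k) C (2 ℕ.* k)) ℕ.* catalan k)

  -- The series Z

  pow-inverse : ∀ {a a⁻¹} → a * a⁻¹ ≈ 1# → ∀ n → pow a n * pow a⁻¹ n ≈ 1#
  pow-inverse             inv zero    = *-identityˡ 1#
  pow-inverse {a} {a⁻¹} inv (suc n) = begin
    a * pow a n * (a⁻¹ * pow a⁻¹ n)       ≈⟨ solve 4 (λ a p i q → a :* p :* (i :* q) := a :* i :* (p :* q)) refl a (pow a n) a⁻¹ (pow a⁻¹ n) ⟩
    a * a⁻¹ * (pow a n * pow a⁻¹ n)       ≈⟨ *-cong inv (pow-inverse inv n) ⟩
    1# * 1#                               ≈⟨ *-identityˡ 1# ⟩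
    1#                                    ∎
    where
    open ≈-Reasoning
    open ≈-Solver

  d-diagonal : ∀ {a a⁻¹} → a * a⁻¹ ≈ 1# → ∀ m → d a a a⁻¹ m ≈ a
  d-diagonal {a} {a⁻¹} inv m = begin
    pow a (2 ℕ.^ m) * pow a⁻¹ e            ≈⟨ *-congʳ (reflexive (≡.cong (pow a) (2^-pred m))) ⟩
    a * pow a e * pow a⁻¹ e                ≈⟨ *-assoc _ _ _ ⟩
    a * (pow a e * pow a⁻¹ e)              ≈⟨ *-congˡ (pow-inverse inv e) ⟩
    a * 1#                                 ≈⟨ *-identityʳ a ⟩
    a                                      ∎
    where
    open ≈-Reasoning
    e = 2 ℕ.^ m ℕ.∸ 1

  module _ (a b a⁻¹ : Carrier) where

    scale : ℕ → Carrier
    scale m = pow b (2 ℕ.^ m) * pow a⁻¹ (2 ℕ.^ m)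

    a*scale≈d : a * a⁻¹ ≈ 1# → ∀ m → a * scale m ≈ d a b a⁻¹ m
    a*scale≈d inv m = begin
      a * (B * pow a⁻¹ (2 ℕ.^ m))           ≈⟨ *-congˡ (*-congˡ (reflexive (≡.cong (pow a⁻¹) (2^-pred m)))) ⟩
      a * (B * (a⁻¹ * I))                   ≈⟨ solve 4 (λ a B i I → a :* (B :* (i :* I)) := a :* i :* (B :* I)) refl a B a⁻¹ I ⟩
      a * a⁻¹ * (B * I)                     ≈⟨ *-congʳ inv ⟩
      1# * (B * I)                          ≈⟨ *-identityˡ _ ⟩
      B * I                                 ∎
      where
      open ≈-Reasoning
      open ≈-Solver
      B = pow b (2 ℕ.^ m)
      I = pow a⁻¹ (2 ℕ.^ m ℕ.∸ 1)

    d*scale≈d-suc : ∀ m → d a b a⁻¹ m * scale m ≈ d a b a⁻¹ (suc m)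
    d*scale≈d-suc m = begin
      B * pow a⁻¹ e * (B * pow a⁻¹ p)                 ≈⟨ solve 3 (λ B u v → B :* u :* (B :* v) := B :* B :* (u :* v)) refl B (pow a⁻¹ e) (pow a⁻¹ p) ⟩
      B * B * (pow a⁻¹ e * pow a⁻¹ p)                 ≈⟨ *-cong (pow-+ b p p) (pow-+ a⁻¹ e p) ⟨
      pow b (p ℕ.+ p) * pow a⁻¹ (e ℕ.+ p)             ≈⟨ reflexive (≡.cong₂ (λ u v → pow b u * pow a⁻¹ v) (≡.sym (2^-suc m)) (≡.sym (2^-suc-pred m))) ⟩
      d a b a⁻¹ (suc m)                               ∎
      where
      open ≈-Reasoning
      open ≈-Solver
      p = 2 ℕ.^ m
      e = p ℕ.∸ 1
      B = pow b p

    d-zero : b ≈ d a b a⁻¹ 0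
    d-zero = sym (trans (*-identityʳ _) (*-identityʳ b))

    d-one : d a b a⁻¹ 1 ≈ pow b 2 * a⁻¹
    d-one = *-congˡ (*-identityʳ a⁻¹)

    d-neg : ∀ m → d a (- b) a⁻¹ (suc m) ≈ d a b a⁻¹ (suc m)
    d-neg m = *-congʳ (begin
      pow (- b) (2 ℕ.^ suc m)                ≈⟨ reflexive (≡.cong (pow (- b)) (2^-suc m)) ⟩
      pow (- b) (p ℕ.+ p)                    ≈⟨ pow-+ (- b) p p ⟩
      pow (- b) p * pow (- b) p              ≈⟨ pow-* (- b) (- b) p ⟨
      pow (- b * - b) p                      ≈⟨ pow-cong p neg*neg ⟩
      pow (b * b) p                          ≈⟨ pow-* b b p ⟩
      pow b p * pow b p                      ≈⟨ pow-+ b p p ⟨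
      pow b (p ℕ.+ p)                        ≈⟨ reflexive (≡.cong (pow b) (2^-suc m)) ⟨
      pow b (2 ℕ.^ suc m)                    ∎)
      where
      open ≈-Reasoning
      p = 2 ℕ.^ m
      neg*neg : - b * - b ≈ b * b
      neg*neg = trans (sym (-‿distribˡ-* b (- b))) (trans (-‿cong (sym (-‿distribʳ-* b b))) (-‿involutive (b * b)))

    Z-ZEquation : a * a⁻¹ ≈ 1# → ∀ m → ZEquation a (d a b a⁻¹ m) (Z a b a⁻¹ m)
    Z-ZEquation inv zero    = ZEquation-cong refl d-zero ≋-refl (S-neg-ZEquation a b)
    Z-ZEquation inv (suc m) = ZEquation-cong refl (d*scale≈d-suc m) ≋-refl
      (graft-ZEquation (Z-ZEquation inv m) (Z-ZEquation inv m) (a*scale≈d inv m))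

    Z1′-ZEquation : a * a⁻¹ ≈ 1# → ZEquation a (pow b 2 * a⁻¹) (Z1′ a b a⁻¹)
    Z1′-ZEquation inv = ZEquation-cong refl b*[b*a⁻¹]≈b²*a⁻¹ ≋-refl
      (graft-ZEquation negX-S-ZEquation (S-ZEquation a b) -a*[b*a⁻¹]≈-b)
      where
      negX-S-ZEquation : ZEquation a (- b) (negX (S a b))
      negX-S-ZEquation = ZEquation-cong refl refl (≋-sym (negX-S a b)) (S-neg-ZEquation a (- b))
      -a*[b*a⁻¹]≈-b : - a * (b * a⁻¹) ≈ - b
      -a*[b*a⁻¹]≈-b = trans (sym (-‿distribˡ-* a _)) (-‿cong (trans (x∙yz≈y∙xz a b a⁻¹) (trans (*-congˡ inv) (*-identityʳ b))))
      b*[b*a⁻¹]≈b²*a⁻¹ : b * (b * a⁻¹) ≈ pow b 2 * a⁻¹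
      b*[b*a⁻¹]≈b²*a⁻¹ = trans (sym (*-assoc b b a⁻¹)) (*-congʳ (*-congˡ (sym (*-identityʳ b))))

lemma2p2 : ∀ {c ℓ} (R : CommutativeRing c ℓ) →
    let open PowerSeries R in
    (a b a⁻¹ : Carrier) → a * a⁻¹ ≈ 1# →
      (Z1′ a b a⁻¹ ≋ one ⊖ a · X* (Z1′ a b a⁻¹) ⊕ (pow b 2 * a⁻¹) · X* (Z1′ a b a⁻¹ ⊛ Z1′ a b a⁻¹))
    ∧ (∀ m → Z a b a⁻¹ m ≋ one ⊖ a · X* (Z a b a⁻¹ m) ⊕ d a b a⁻¹ m · X* (Z a b a⁻¹ m ⊛ Z a b a⁻¹ m))
    ∧ (∀ m → Z a b a⁻¹ m ≋ S (- a) (d a b a⁻¹ m))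
    ∧ (∀ m → Z a b a⁻¹ (suc m) ≋ Z a (- b) a⁻¹ (suc m))
    ∧ (∀ m → Z a a a⁻¹ m ≋ S (- a) a)
    ∧ (S (- a) a ≋ one)
    ∧ (Z1′ a b a⁻¹ ≋ Z a b a⁻¹ 1)
lemma2p2 R a b a⁻¹ inv =
    ZEquation⇒equation (Z1′-ZEquation a b a⁻¹ inv)
  , (λ m → ZEquation⇒equation (Z-ZEquation a b a⁻¹ inv m))
  , (λ m → ZEquation-unique (Z-ZEquation a b a⁻¹ inv m) (S-neg-ZEquation a (d a b a⁻¹ m)))
  , (λ m → ZEquation-unique (Z-ZEquation a b a⁻¹ inv (suc m))
             (ZEquation-cong refl (d-neg a b a⁻¹ m) ≋-refl (Z-ZEquation a (- b) a⁻¹ inv (suc m))))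
  , (λ m → ZEquation-unique (ZEquation-cong refl (d-diagonal inv m) ≋-refl (Z-ZEquation a a a⁻¹ inv m)) (S-neg-ZEquation a a))
  , ZEquation-unique (S-neg-ZEquation a a) (ZEquation-one a)
  , ZEquation-unique (Z1′-ZEquation a b a⁻¹ inv) (ZEquation-cong refl (d-one a b a⁻¹) ≋-refl (Z-ZEquation a b a⁻¹ inv 1))
  where open Series R
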